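{- Let $n$ and $d$ be positive integers with $d<n-1$. An additive quaternary $[n,2.5,d]$-code exists if and only if $$3(n-d)\geq \lceil d/2\rceil +\lceil d/4\rceil +\lceil d/8\rceil .$$
   Context: For $k$ with $2k$ a positive integer, an additive quaternary $[n,k,d]$-code is a $2k$-dimensional $\mathbb{F}_2$-linear subspace $C$ of $\mathbb{F}_2^{2n}$ whose coordinates are grouped into $n$ consecutive pairs, so that codewords are viewed as $n$-tuples with entries in $\mathbb{F}_2^2$; $n$ is the length, $k$ the (quaternary) dimension, and $d$ the minimum Hamming distance of $C$ measured over these $n$ symbols in $\mathbb{F}_2^2$ (i.e. the minimum number of nonzero pairs in a nonzero codeword). Thus a $[n,2.5,d]$-code is a $5$-dimensional $\mathbb{F}_2$-space of such $n$-tuples. -}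

module Defs where

open import Data.Nat using (ℕ; zero; suc; _+_; _/_)
open import Data.Bool using (Bool; true; false; _xor_; _∧_; if_then_else_)
open import Data.Product using (_×_; _,_; Σ; ∃)
open import Data.Fin using (Fin; zero; suc)
open import Relation.Binary.PropositionalEquality using (_≡_; _≢_)

-- An element of F₂² (one quaternary symbol), as a pair of bits.
Sym : Set
Sym = Bool × Bool

zeroSym : Sym
zeroSym = false , false

_⊕_ : Sym → Sym → Sym
(a , b) ⊕ (c , d) = (a xor c) , (b xor d)

_·_ : Bool → Sym → Sym
c · (a , b) = (c ∧ a) , (c ∧ b)

Word : ℕ → Set
Word n = Fin n → Sym

zeroWord : ∀ n → Word n
zeroWord n i = zeroSym

nz : Sym → ℕ
nz (false , false) = 0
nz _               = 1

wt : ∀ n → Word n → ℕ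
wt zero    w = 0
wt (suc n) w = nz (w zero) + wt n (λ i → w (suc i))

lin : ∀ {n} k → (Fin k → Word n) → (Fin k → Bool) → Word n
lin zero    g c i = zeroSym
lin (suc k) g c i = (c zero · g zero i) ⊕ lin k (λ j → g (suc j)) (λ j → c (suc j)) i

NonZeroCoeffs : ∀ {k} → (Fin k → Bool) → Set
NonZeroCoeffs {k} c = Σ (Fin k) (λ j → c j ≡ true)

-- An additive quaternary [n, m/2, d]-code, presented by an F₂-basis of
-- m generators g_0 … g_{m-1} ∈ F₂^{2n}: the code is their F₂-span, which is
-- m-dimensional since the generators are linearly independent, and its
-- minimum distance (= minimum weight of a nonzero codeword, by linearity)
-- is exactly d.
record AdditiveCode (n m d : ℕ) : Set where
  field
    gen         : Fin m → Word n
    independent : (c : Fin m → Bool) → NonZeroCoeffs c → lin m gen c ≢ zeroWord n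
    weight≥     : (c : Fin m → Bool) → NonZeroCoeffs c → d Data.Nat.≤ wt n (lin m gen c)
    attained    : Σ (Fin m → Bool) (λ c → NonZeroCoeffs c × (wt n (lin m gen c) ≡ d))

⌈_/suc_⌉ : ℕ → ℕ → ℕ
⌈ m /suc k ⌉ = (m + k) / suc k

module Submission where

-- Necessity.  Composing each coordinate with the three nonzero F₂-linear maps
-- F₂² → F₂ turns an additive [n, 2.5, d] code into a binary linear [3n, 5, 2d]
-- code: a nonzero symbol survives exactly two of the three maps.  The binary
-- Griesmer bound, proved here for arbitrary dimension and coordinate set, gives
-- 3n ≥ Σ_{i<5} ⌈2d/2^i⌉ = 3d + ⌈d/2⌉ + ⌈d/4⌉ + ⌈d/8⌉.
--
-- Sufficiency.  Juxtaposing codes adds weights,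
-- so a base code of minimum weight b ≤ 26, followed by j copies of a one-weight
-- [31, 2.5, 24] code and by zero columns, has minimum weight b + 24j on any
-- larger length.

open import Defs
open import Data.Nat using (ℕ; zero; suc; _+_; _*_; _≤_; _<_; _∸_; z≤n; s≤s; _/_; _%_; _≡ᵇ_; NonZero)
open import Data.Nat.Properties
open import Data.Nat.DivMod using (+-distrib-/-∣ʳ; m*n/n≡m; m/n/o≡m/[n*o]; /-congˡ; /-congʳ; m≡m%n+[m/n]*n; m%n<n)
open import Data.Nat.Tactic.RingSolver using (solve-∀)
open import Data.Nat.Divisibility using (divides-refl)
open import Data.Bool using (Bool; true; false; not; _∧_; _xor_; T)
open import Data.Bool.Properties using (∧-distribʳ-xor; xor-∧-commutativeRing; T-∧)
open import Algebra.Bundles using (CommutativeRing)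
open import Algebra.Properties.CommutativeSemigroup (CommutativeRing.+-commutativeSemigroup xor-∧-commutativeRing)
  using () renaming (interchange to xor-interchange)
open import Data.Fin using (Fin; zero; suc)
open import Data.Vec using (Vec; []; _∷_; lookup; tabulate; zipWith; _++_; concat; replicate)
open import Data.Vec.Properties using (lookup-zipWith; tabulate∘lookup)
open import Data.Vec.Relation.Unary.Any using (Any; here; there)
open import Data.Product using (Σ; _×_; _,_; proj₁; proj₂)
open import Relation.Binary.PropositionalEquality
open import Function.Bundles using (_⇔_; mk⇔; Equivalence)
open import Relation.Nullary using (yes; no)
open import Relation.Nullary.Decidable using (from-yes; _→-dec_)
open import Algebra.Properties.CommutativeMonoid.Sum +-0-commutativeMonoid
  using (sum; sum-cong-≗; ∑-distrib-+)

_⊻_ : ∀ {k} → Vec Bool k → Vec Bool k → Vec Bool k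
_⊻_ = zipWith _xor_

Nonzero : ∀ {k} → Vec Bool k → Set
Nonzero = Any (_≡ true)

lookup-nonzero : ∀ {k} (v : Vec Bool k) → Nonzero v → NonZeroCoeffs (lookup v)
lookup-nonzero (b ∷ v) (here b≡1) = zero , b≡1
lookup-nonzero (b ∷ v) (there v≢0) = let (j , vⱼ≡1) = lookup-nonzero v v≢0 in suc j , vⱼ≡1

tabulate-nonzero : ∀ {k} (c : Fin k → Bool) → NonZeroCoeffs c → Nonzero (tabulate c)
tabulate-nonzero c (zero , c₀≡1) = here c₀≡1
tabulate-nonzero c (suc j , cⱼ≡1) = there (tabulate-nonzero (λ i → c (suc i)) (j , cⱼ≡1))

-- For a nonzero c ∈ F₂^(k+1), a linear map F₂^k → F₂^(k+1) whose image is a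
-- complement of ⟨c⟩: it leaves the first coordinate where c is 1 at zero.
complement : ∀ {k} (c : Vec Bool (suc k)) → Nonzero c → Vec Bool k → Vec Bool (suc k)
complement (true ∷ c) _ a = false ∷ a
complement (false ∷ x ∷ c) (there c≢0) (y ∷ a) = y ∷ complement (x ∷ c) c≢0 a

complement-⊻ : ∀ {k} (c : Vec Bool (suc k)) (c≢0 : Nonzero c) a b →
  complement c c≢0 (a ⊻ b) ≡ complement c c≢0 a ⊻ complement c c≢0 b
complement-⊻ (true ∷ c) _ a b = refl
complement-⊻ (false ∷ x ∷ c) (there c≢0) (y ∷ a) (z ∷ b) =
  cong ((y xor z) ∷_) (complement-⊻ (x ∷ c) c≢0 a b)

complement-nonzero : ∀ {k} (c : Vec Bool (suc k)) (c≢0 : Nonzero c) a →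
  Nonzero a → Nonzero (complement c c≢0 a)
complement-nonzero (true ∷ c) _ a a≢0 = there a≢0
complement-nonzero (false ∷ x ∷ c) (there c≢0) (y ∷ a) (here y≡1) = here y≡1
complement-nonzero (false ∷ x ∷ c) (there c≢0) (y ∷ a) (there a≢0) =
  there (complement-nonzero (x ∷ c) c≢0 a a≢0)

complement-avoids : ∀ {k} (c : Vec Bool (suc k)) (c≢0 : Nonzero c) a →
  Nonzero a → Nonzero (complement c c≢0 a ⊻ c)
complement-avoids (true ∷ c) _ a _ = here refl
complement-avoids (false ∷ x ∷ c) (there c≢0) (true ∷ a) _ = here refl
complement-avoids (false ∷ x ∷ c) (there c≢0) (false ∷ a) (there a≢0) =
  there (complement-avoids (x ∷ c) c≢0 a a≢0)

minimiser : ∀ k (h : Vec Bool k → ℕ) → Σ (Vec Bool k) λ c → ∀ c' → h c ≤ h c'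
minimiser zero h = [] , λ { [] → ≤-refl }
minimiser (suc k) h with minimiser k (λ v → h (true ∷ v)) | minimiser k (λ v → h (false ∷ v))
... | u , u-min | v , v-min with h (true ∷ u) ≤? h (false ∷ v)
...   | yes u≤v = true ∷ u , λ { (true ∷ w) → u-min w
                              ; (false ∷ w) → ≤-trans u≤v (v-min w) }
...   | no u≰v = false ∷ v , λ { (true ∷ w) → ≤-trans (<⇒≤ (≰⇒> u≰v)) (u-min w)
                              ; (false ∷ w) → v-min w }

nonzeroMinimiser : ∀ k (h : Vec Bool (suc k) → ℕ) →
  Σ (Vec Bool (suc k)) λ c → Nonzero c × (∀ c' → Nonzero c' → h c ≤ h c')
nonzeroMinimiser zero h = true ∷ [] , here refl , λ { (true ∷ []) _ → ≤-refl ; (false ∷ []) (here ()) }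
nonzeroMinimiser (suc k) h
  with minimiser (suc k) (λ v → h (true ∷ v)) | nonzeroMinimiser k (λ v → h (false ∷ v))
... | u , u-min | v , v≢0 , v-min with h (true ∷ u) ≤? h (false ∷ v)
...   | yes u≤v = true ∷ u , here refl , λ { (true ∷ w) _ → u-min w
                                         ; (false ∷ w) (there w≢0) → ≤-trans u≤v (v-min w w≢0) }
...   | no u≰v = false ∷ v , there v≢0 , λ { (true ∷ w) _ → ≤-trans (<⇒≤ (≰⇒> u≰v)) (u-min w)
                                         ; (false ∷ w) (there w≢0) → v-min w w≢0 }

half↑ : ℕ → ℕ
half↑ zero = zero
half↑ (suc zero) = suc zero
half↑ (suc (suc x)) = suc (half↑ x)

half↑-mono : ∀ {x y} → x ≤ y → half↑ x ≤ half↑ y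
half↑-mono {zero} _ = z≤n
half↑-mono {suc zero} {suc zero} _ = ≤-refl
half↑-mono {suc zero} {suc (suc y)} _ = s≤s z≤n
half↑-mono {suc (suc x)} {suc (suc y)} (s≤s (s≤s x≤y)) = s≤s (half↑-mono x≤y)

half↑-≤ : ∀ x w → x ≤ w + w → half↑ x ≤ w
half↑-≤ zero w _ = z≤n
half↑-≤ (suc zero) (suc w) _ = s≤s z≤n
half↑-≤ (suc (suc x)) (suc w) (s≤s x≤) rewrite +-suc w w = s≤s (half↑-≤ x w (≤-pred x≤))

-- g_k(D) = Σ_{i<k} ⌈D/2^i⌉, the Griesmer bound for binary codes of dimension k
-- and minimum weight D; written with iterated halving ⌈⌈D/2⌉/2⌉ = ⌈D/4⌉, ….
griesmerSum : ℕ → ℕ → ℕ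
griesmerSum zero D = 0
griesmerSum (suc k) D = D + griesmerSum k (half↑ D)

griesmerSum-mono : ∀ k {D D'} → D ≤ D' → griesmerSum k D ≤ griesmerSum k D'
griesmerSum-mono zero _ = z≤n
griesmerSum-mono (suc k) D≤D' = +-mono-≤ D≤D' (griesmerSum-mono k (half↑-mono D≤D'))

indicator : Bool → ℕ
indicator true = 1
indicator false = 0

-- A code is an additive encoder F₂^k → F₂^I; weights
-- are measured inside a support s ⊆ I.  Proof (Griesmer): take a nonzero message
-- c of minimum weight D₀ ≥ D; outside the support of its codeword the code
-- restricted to a complement of ⟨c⟩ still has minimum weight ≥ ⌈D₀/2⌉, and
-- induction on k finishes.
module Griesmer {I : Set} (∑ : (I → ℕ) → ℕ)
  (∑-cong : ∀ {f g} → (∀ i → f i ≡ g i) → ∑ f ≡ ∑ g)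
  (∑-+ : ∀ f g → ∑ (λ i → f i + g i) ≡ ∑ f + ∑ g) where

  weightIn : (I → Bool) → (I → Bool) → ℕ
  weightIn s x = ∑ (λ i → indicator (s i ∧ x i))

  size : (I → Bool) → ℕ
  size s = ∑ (λ i → indicator (s i))

  Additive : ∀ {k} → (Vec Bool k → I → Bool) → Set
  Additive enc = ∀ a b i → enc (a ⊻ b) i ≡ enc a i xor enc b i

  private
    pair-count : ∀ s x e → indicator (s ∧ x) + indicator (s ∧ (x xor e))
                         ≡ indicator (s ∧ e) + (indicator ((s ∧ not e) ∧ x) + indicator ((s ∧ not e) ∧ x))
    pair-count false x e = refl
    pair-count true true true = refl
    pair-count true true false = refl
    pair-count true false true = refl
    pair-count true false false = refl

    split-count : ∀ s e → indicator s ≡ indicator (s ∧ e) + indicator (s ∧ not e)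
    split-count false e = refl
    split-count true true = refl
    split-count true false = refl

  _without_ : (I → Bool) → (I → Bool) → I → Bool
  (s without e) i = s i ∧ not (e i)

  size-split : ∀ s e → size s ≡ weightIn s e + size (s without e)
  size-split s e = trans (∑-cong (λ i → split-count (s i) (e i))) (∑-+ _ _)

  pair-weight : ∀ {k} (enc : Vec Bool k → I → Bool) → Additive enc → ∀ s x e →
    weightIn s (enc x) + weightIn s (enc (x ⊻ e))
      ≡ weightIn s (enc e) + (weightIn (s without enc e) (enc x) + weightIn (s without enc e) (enc x))
  pair-weight enc additive s x e = begin
    weightIn s (enc x) + weightIn s (enc (x ⊻ e))
      ≡⟨ ∑-+ _ _ ⟨
    ∑ (λ i → indicator (s i ∧ enc x i) + indicator (s i ∧ enc (x ⊻ e) i))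
      ≡⟨ ∑-cong (λ i → trans (cong (λ b → indicator (s i ∧ enc x i) + indicator (s i ∧ b)) (additive x e i))
                             (pair-count (s i) (enc x i) (enc e i))) ⟩
    ∑ (λ i → indicator (s i ∧ enc e i) + (indicator (s' i ∧ enc x i) + indicator (s' i ∧ enc x i)))
      ≡⟨ ∑-+ _ _ ⟩
    weightIn s (enc e) + ∑ (λ i → indicator (s' i ∧ enc x i) + indicator (s' i ∧ enc x i))
      ≡⟨ cong (weightIn s (enc e) +_) (∑-+ _ _) ⟩
    weightIn s (enc e) + (weightIn s' (enc x) + weightIn s' (enc x)) ∎
    where
    open ≡-Reasoning
    s' = s without enc e

  griesmer : ∀ k (enc : Vec Bool k → I → Bool) → Additive enc → ∀ s D →
    (∀ c → Nonzero c → D ≤ weightIn s (enc c)) → griesmerSum k D ≤ size s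
  griesmer zero enc additive s D weight≥ = z≤n
  griesmer (suc k) enc additive s D weight≥ = begin
    D + griesmerSum k (half↑ D)     ≤⟨ +-mono-≤ D≤D₀ (griesmerSum-mono k (half↑-mono D≤D₀)) ⟩
    D₀ + griesmerSum k (half↑ D₀)   ≤⟨ +-monoʳ-≤ D₀ residual-bound ⟩
    D₀ + size s'                    ≡⟨ size-split s (enc c₀) ⟨
    size s                          ∎
    where
    open ≤-Reasoning
    minimal = nonzeroMinimiser k (λ c → weightIn s (enc c))
    c₀ = proj₁ minimal
    c₀≢0 = proj₁ (proj₂ minimal)
    D₀ = weightIn s (enc c₀)
    D≤D₀ = weight≥ c₀ c₀≢0

    s' : I → Bool
    s' = s without enc c₀

    enc' : Vec Bool k → I → Bool
    enc' a = enc (complement c₀ c₀≢0 a)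

    additive' : Additive enc'
    additive' a b i = trans (cong (λ v → enc v i) (complement-⊻ c₀ c₀≢0 a b)) (additive _ _ i)

    -- both x and x + c₀ have weight ≥ D₀, hence x has weight ≥ ⌈D₀/2⌉ off supp(c₀)
    residual-weight : ∀ a → Nonzero a → half↑ D₀ ≤ weightIn s' (enc' a)
    residual-weight a a≢0 = half↑-≤ D₀ _ (+-cancelˡ-≤ D₀ _ _
      (subst (D₀ + D₀ ≤_) (pair-weight enc additive s x c₀)
        (+-mono-≤ (minimum x (complement-nonzero c₀ c₀≢0 a a≢0)) (minimum (x ⊻ c₀) (complement-avoids c₀ c₀≢0 a a≢0)))))
      where
      x = complement c₀ c₀≢0 a
      minimum = proj₂ (proj₂ minimal)

    residual-bound : griesmerSum k (half↑ D₀) ≤ size s'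
    residual-bound = griesmer k enc' additive' s' (half↑ D₀) residual-weight

-- An additive code, read through the three nonzero F₂-linear functionals
-- F₂² → F₂, becomes a binary code of length 3n in which every weight doubles.
functional : Fin 3 → Sym → Bool
functional zero (a , b) = a
functional (suc zero) (a , b) = b
functional (suc (suc zero)) (a , b) = a xor b

functional-⊕ : ∀ t x y → functional t (x ⊕ y) ≡ functional t x xor functional t y
functional-⊕ zero x y = refl
functional-⊕ (suc zero) x y = refl
functional-⊕ (suc (suc zero)) (a , b) (c , d) = xor-interchange a c b d

-- a nonzero symbol is annihilated by exactly one of the three functionals
functional-count : ∀ x → sum (λ t → indicator (functional t x)) ≡ nz x + nz x
functional-count (true , true) = refl
functional-count (true , false) = refl
functional-count (false , true) = refl
functional-count (false , false) = refl

·-⊕ : ∀ a b u x y → ((a xor b) · u) ⊕ (x ⊕ y) ≡ ((a · u) ⊕ x) ⊕ ((b · u) ⊕ y)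
·-⊕ a b (u , v) (x₁ , x₂) (y₁ , y₂) = cong₂ _,_ (component u x₁ y₁) (component v x₂ y₂)
  where
  component : ∀ u x y → ((a xor b) ∧ u) xor (x xor y) ≡ ((a ∧ u) xor x) xor ((b ∧ u) xor y)
  component u x y = trans (cong (_xor (x xor y)) (∧-distribʳ-xor u a b)) (xor-interchange (a ∧ u) (b ∧ u) x y)

lin-⊻ : ∀ {n} k (g : Fin k → Word n) c₁ c₂ c → (∀ j → c j ≡ c₁ j xor c₂ j) → ∀ i →
  lin k g c i ≡ lin k g c₁ i ⊕ lin k g c₂ i
lin-⊻ zero g c₁ c₂ c c≡ i = refl
lin-⊻ (suc k) g c₁ c₂ c c≡ i =
  trans (cong₂ (λ a x → (a · g zero i) ⊕ x) (c≡ zero)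
                 (lin-⊻ k (λ j → g (suc j)) (λ j → c₁ (suc j)) (λ j → c₂ (suc j)) (λ j → c (suc j)) (λ j → c≡ (suc j)) i))
        (·-⊕ (c₁ zero) (c₂ zero) (g zero i) _ _)

wt≡sum : ∀ n (w : Word n) → wt n w ≡ sum (λ i → nz (w i))
wt≡sum zero w = refl
wt≡sum (suc n) w = cong (nz (w zero) +_) (wt≡sum n (λ i → w (suc i)))

sum-const : ∀ n k → sum {n} (λ _ → k) ≡ n * k
sum-const zero k = refl
sum-const (suc n) k = cong (k +_) (sum-const n k)

∑₃ : ∀ {n} → (Fin n × Fin 3 → ℕ) → ℕ
∑₃ f = sum (λ i → sum (λ t → f (i , t)))

∑₃-cong : ∀ {n} {f g : Fin n × Fin 3 → ℕ} → (∀ i → f i ≡ g i) → ∑₃ f ≡ ∑₃ g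
∑₃-cong f≡g = sum-cong-≗ (λ i → sum-cong-≗ (λ t → f≡g (i , t)))

∑₃-+ : ∀ {n} (f g : Fin n × Fin 3 → ℕ) → ∑₃ (λ i → f i + g i) ≡ ∑₃ f + ∑₃ g
∑₃-+ f g = trans (sum-cong-≗ (λ i → ∑-distrib-+ (λ t → f (i , t)) (λ t → g (i , t))))
                   (∑-distrib-+ (λ i → sum (λ t → f (i , t))) (λ i → sum (λ t → g (i , t))))

-- The Griesmer bound for additive codes: an additive [n, m/2, d] code yields a
-- binary linear [3n, m, 2d] code, so g_m(2d) ≤ 3n.
additiveGriesmer : ∀ {n m d} → AdditiveCode n m d → griesmerSum m (d + d) ≤ 3 * n
additiveGriesmer {n} {m} {d} C =
  subst (griesmerSum m (d + d) ≤_) full-size (griesmer m binary binary-additive (λ _ → true) (d + d) binary-weight)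
  where
  open AdditiveCode C
  open Griesmer (∑₃ {n}) ∑₃-cong ∑₃-+

  binary : Vec Bool m → Fin n × Fin 3 → Bool
  binary v (i , t) = functional t (lin m gen (lookup v) i)

  binary-additive : Additive binary
  binary-additive a b (i , t) =
    trans (cong (functional t) (lin-⊻ m gen (lookup a) (lookup b) (lookup (a ⊻ b)) (λ j → lookup-zipWith _xor_ j a b) i))
          (functional-⊕ t _ _)

  doubled : ∀ w → weightIn (λ _ → true) (λ { (i , t) → functional t (w i) }) ≡ wt n w + wt n w
  doubled w = begin
    sum (λ i → sum (λ t → indicator (functional t (w i))))
      ≡⟨ sum-cong-≗ (λ i → functional-count (w i)) ⟩
    sum (λ i → nz (w i) + nz (w i))
      ≡⟨ ∑-distrib-+ (λ i → nz (w i)) (λ i → nz (w i)) ⟩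
    sum (λ i → nz (w i)) + sum (λ i → nz (w i))
      ≡⟨ cong₂ _+_ (wt≡sum n w) (wt≡sum n w) ⟨
    wt n w + wt n w ∎
    where open ≡-Reasoning

  binary-weight : ∀ v → Nonzero v → d + d ≤ weightIn (λ _ → true) (binary v)
  binary-weight v v≢0 = subst (d + d ≤_) (sym (doubled (lin m gen (lookup v)))) (+-mono-≤ w≥d w≥d)
    where w≥d = weight≥ (lookup v) (lookup-nonzero v v≢0)

  full-size : size (λ _ → true) ≡ 3 * n
  full-size = trans (sum-const n 3) (*-comm n 3)

ceilingSum : ℕ → ℕ
ceilingSum d = ⌈ d /suc 1 ⌉ + ⌈ d /suc 3 ⌉ + ⌈ d /suc 7 ⌉

/-+-multiple : ∀ x k m .{{_ : NonZero m}} → (x + k * m) / m ≡ x / m + k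
/-+-multiple x k m = trans (+-distrib-/-∣ʳ x (divides-refl k)) (cong (x / m +_) (m*n/n≡m k m))

half↑-double : ∀ d → half↑ (d + d) ≡ d
half↑-double zero = refl
half↑-double (suc d) rewrite +-suc d d = cong suc (half↑-double d)

half↑≡⌈/2⌉ : ∀ x → half↑ x ≡ ⌈ x /suc 1 ⌉
half↑≡⌈/2⌉ zero = refl
half↑≡⌈/2⌉ (suc zero) = refl
half↑≡⌈/2⌉ (suc (suc x)) = begin
  suc (half↑ x)            ≡⟨ cong suc (half↑≡⌈/2⌉ x) ⟩
  suc ((x + 1) / 2)        ≡⟨ +-comm 1 _ ⟩
  (x + 1) / 2 + 1          ≡⟨ /-+-multiple (x + 1) 1 2 ⟨
  (x + 1 + 1 * 2) / 2      ≡⟨ /-congˡ {o = 2} (numerator x) ⟩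
  (suc (suc x) + 1) / 2    ∎
  where
  open ≡-Reasoning
  numerator : ∀ x → x + 1 + 1 * 2 ≡ suc (suc x) + 1
  numerator = solve-∀

half↑-⌈/⌉ : ∀ d m → half↑ ⌈ d /suc m ⌉ ≡ ⌈ d /suc (suc (m + m)) ⌉
half↑-⌈/⌉ d m = begin
  half↑ ((d + m) / suc m)                    ≡⟨ half↑≡⌈/2⌉ _ ⟩
  ((d + m) / suc m + 1) / 2                  ≡⟨ /-congˡ {o = 2} (/-+-multiple (d + m) 1 (suc m)) ⟨
  (d + m + 1 * suc m) / suc m / 2            ≡⟨ m/n/o≡m/[n*o] (d + m + 1 * suc m) (suc m) 2 ⟩
  (d + m + 1 * suc m) / (suc m * 2)          ≡⟨ /-congˡ {o = suc m * 2} (numerator d m) ⟩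
  (d + suc (m + m)) / (suc m * 2)            ≡⟨ /-congʳ {m = d + suc (m + m)} (denominator m) ⟩
  (d + suc (m + m)) / suc (suc (m + m))      ∎
  where
  open ≡-Reasoning
  numerator : ∀ d m → d + m + 1 * suc m ≡ d + suc (m + m)
  numerator = solve-∀
  denominator : ∀ m → suc m * 2 ≡ suc (suc (m + m))
  denominator = solve-∀

griesmerSum-5 : ∀ d → griesmerSum 5 (d + d) ≡ 3 * d + ceilingSum d
griesmerSum-5 d
  rewrite half↑-double d | half↑≡⌈/2⌉ d | half↑-⌈/⌉ d 1 | half↑-⌈/⌉ d 3 =
  regroup d ⌈ d /suc 1 ⌉ ⌈ d /suc 3 ⌉ ⌈ d /suc 7 ⌉
  where
  regroup : ∀ d a b c → d + d + (d + (a + (b + (c + 0)))) ≡ 3 * d + (a + b + c)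
  regroup = solve-∀

necessity : ∀ n d → AdditiveCode n 5 d → ceilingSum d ≤ 3 * (n ∸ d)
necessity n d C = begin
  ceilingSum d      ≤⟨ m+n≤o⇒m≤o∸n (ceilingSum d) griesmer-bound ⟩
  3 * n ∸ 3 * d     ≡⟨ *-distribˡ-∸ 3 n d ⟨
  3 * (n ∸ d)       ∎
  where
  open ≤-Reasoning
  griesmer-bound : ceilingSum d + 3 * d ≤ 3 * n
  griesmer-bound = subst (_≤ 3 * n) (trans (griesmerSum-5 d) (+-comm (3 * d) _)) (additiveGriesmer C)

-- Codes given by columns: position i carries a column in (F₂²)^k, and the
-- message v ∈ F₂^k is encoded there as the symbol Σ_j v_j · column_j.
Column : ℕ → Set
Column k = Vec Sym k

symbolAt : ∀ {k} → Column k → Vec Bool k → Sym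
symbolAt [] [] = zeroSym
symbolAt (x ∷ xs) (b ∷ bs) = (b · x) ⊕ symbolAt xs bs

weight : ∀ {k n} → Vec (Column k) n → Vec Bool k → ℕ
weight {n = n} cs v = wt n (λ i → symbolAt (lookup cs i) v)

weight-++ : ∀ {k m n} (cs : Vec (Column k) m) (ds : Vec (Column k) n) v →
  weight (cs ++ ds) v ≡ weight cs v + weight ds v
weight-++ [] ds v = refl
weight-++ (c ∷ cs) ds v =
  trans (cong (nz (symbolAt c v) +_) (weight-++ cs ds v)) (sym (+-assoc (nz (symbolAt c v)) (weight cs v) (weight ds v)))

weight-repeat : ∀ {k n} j (cs : Vec (Column k) n) v → weight (concat (replicate j cs)) v ≡ j * weight cs v
weight-repeat zero cs v = refl
weight-repeat (suc j) cs v = trans (weight-++ cs _ v) (cong (weight cs v +_) (weight-repeat j cs v))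

zeroColumn : ∀ {k} → Column k
zeroColumn {k} = replicate k zeroSym

symbolAt-zero : ∀ {k} (v : Vec Bool k) → symbolAt zeroColumn v ≡ zeroSym
symbolAt-zero [] = refl
symbolAt-zero (true ∷ v) rewrite symbolAt-zero v = refl
symbolAt-zero (false ∷ v) rewrite symbolAt-zero v = refl

weight-zeroColumns : ∀ {k} z (v : Vec Bool k) → weight (replicate z zeroColumn) v ≡ 0
weight-zeroColumns zero v = refl
weight-zeroColumns (suc z) v rewrite symbolAt-zero v = weight-zeroColumns z v

record MinimumWeight {k n} (cs : Vec (Column k) n) (d : ℕ) : Set where
  field
    lower : ∀ v → Nonzero v → d ≤ weight cs v
    attained : Σ (Vec Bool k) λ v → Nonzero v × weight cs v ≡ d

-- The minimum weight of a column code, computed by exhaustive search, so that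
-- for explicit codes it is obtained by evaluation.
minimumWeight : ∀ {k n} → Vec (Column (suc k)) n → ℕ
minimumWeight {k} cs = weight cs (proj₁ (nonzeroMinimiser k (weight cs)))

minimumWeight-correct : ∀ {k n} (cs : Vec (Column (suc k)) n) → MinimumWeight cs (minimumWeight cs)
minimumWeight-correct {k} cs = record
  { lower = proj₂ (proj₂ minimal)
  ; attained = proj₁ minimal , proj₁ (proj₂ minimal) , refl }
  where minimal = nonzeroMinimiser k (weight cs)

every : ∀ k → (Vec Bool k → Bool) → Bool
every zero P = P []
every (suc k) P = every k (λ v → P (true ∷ v)) ∧ every k (λ v → P (false ∷ v))

everyNonzero : ∀ k → (Vec Bool k → Bool) → Bool
everyNonzero zero P = true
everyNonzero (suc k) P = every k (λ v → P (true ∷ v)) ∧ everyNonzero k (λ v → P (false ∷ v))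

every-sound : ∀ k P → T (every k P) → ∀ v → T (P v)
every-sound zero P ok [] = ok
every-sound (suc k) P ok (true ∷ v) = every-sound k _ (proj₁ (Equivalence.to T-∧ ok)) v
every-sound (suc k) P ok (false ∷ v) = every-sound k _ (proj₂ (Equivalence.to T-∧ ok)) v

everyNonzero-sound : ∀ k P → T (everyNonzero k P) → ∀ v → Nonzero v → T (P v)
everyNonzero-sound (suc k) P ok (true ∷ v) _ = every-sound k _ (proj₁ (Equivalence.to T-∧ ok)) v
everyNonzero-sound (suc k) P ok (false ∷ v) (there v≢0) =
  everyNonzero-sound k _ (proj₂ (Equivalence.to T-∧ ok)) v v≢0

rows : ∀ {k n} → Vec (Column k) n → Fin k → Word n
rows cs j i = lookup (lookup cs i) j

lin-column : ∀ {n} k (g : Fin k → Word n) c i → lin k g c i ≡ symbolAt (tabulate (λ j → g j i)) (tabulate c)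
lin-column zero g c i = refl
lin-column (suc k) g c i = cong ((c zero · g zero i) ⊕_) (lin-column k (λ j → g (suc j)) (λ j → c (suc j)) i)

wt-cong : ∀ n {w w' : Word n} → (∀ i → w i ≡ w' i) → wt n w ≡ wt n w'
wt-cong n {w} {w'} w≡w' = begin
  wt n w                    ≡⟨ wt≡sum n w ⟩
  sum (λ i → nz (w i))      ≡⟨ sum-cong-≗ (λ i → cong nz (w≡w' i)) ⟩
  sum (λ i → nz (w' i))     ≡⟨ wt≡sum n w' ⟨
  wt n w' ∎
  where open ≡-Reasoning

lin-rows-weight : ∀ {k n} (cs : Vec (Column k) n) c → wt n (lin k (rows cs) c) ≡ weight cs (tabulate c)
lin-rows-weight {k} {n} cs c = wt-cong n λ i →
  trans (lin-column k (rows cs) c i) (cong (λ col → symbolAt col (tabulate c)) (tabulate∘lookup (lookup cs i)))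

toAdditiveCode : ∀ {k n d} (cs : Vec (Column k) n) → 1 ≤ d → MinimumWeight cs d → AdditiveCode n k d
toAdditiveCode {k} {n} {d} cs 1≤d mw = record
  { gen = rows cs
  ; independent = λ c c≢0 c≡0 → <⇒≱ 1≤d (subst (d ≤_) (trans (cong (wt n) c≡0) (wt-zeroWord n)) (weight≥ c c≢0))
  ; weight≥ = weight≥
  ; attained = lookup v , lookup-nonzero v v≢0 ,
      trans (lin-rows-weight cs (lookup v)) (trans (cong (weight cs) (tabulate∘lookup v)) v-weight) }
  where
  open MinimumWeight mw
  v = proj₁ attained
  v≢0 = proj₁ (proj₂ attained)
  v-weight = proj₂ (proj₂ attained)

  weight≥ : ∀ c → NonZeroCoeffs c → d ≤ wt n (lin k (rows cs) c)
  weight≥ c c≢0 = subst (d ≤_) (sym (lin-rows-weight cs c)) (lower (tabulate c) (tabulate-nonzero c c≢0))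

  wt-zeroWord : ∀ n → wt n (zeroWord n) ≡ 0
  wt-zeroWord zero = refl
  wt-zeroWord (suc n) = wt-zeroWord n

module Extension {k m w} (oneWeight : Vec (Column k) m) (one-weight : ∀ v → Nonzero v → weight oneWeight v ≡ w) where

  extend : ∀ {n} j z → Vec (Column k) n → Vec (Column k) (n + (j * m + z))
  extend j z cs = cs ++ (concat (replicate j oneWeight) ++ replicate z zeroColumn)

  extend-weight : ∀ {n} j z (cs : Vec (Column k) n) v → Nonzero v → weight (extend j z cs) v ≡ weight cs v + j * w
  extend-weight j z cs v v≢0 = begin
    weight (extend j z cs) v
      ≡⟨ weight-++ cs _ v ⟩
    weight cs v + weight (concat (replicate j oneWeight) ++ replicate z zeroColumn) v
      ≡⟨ cong (weight cs v +_) (weight-++ (concat (replicate j oneWeight)) _ v) ⟩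
    weight cs v + (weight (concat (replicate j oneWeight)) v + weight (replicate z zeroColumn) v)
      ≡⟨ cong (λ x → weight cs v + (x + weight (replicate z zeroColumn) v)) (weight-repeat j oneWeight v) ⟩
    weight cs v + (j * weight oneWeight v + weight (replicate z zeroColumn) v)
      ≡⟨ cong₂ (λ x y → weight cs v + (j * x + y)) (one-weight v v≢0) (weight-zeroColumns z v) ⟩
    weight cs v + (j * w + 0)
      ≡⟨ cong (weight cs v +_) (+-identityʳ (j * w)) ⟩
    weight cs v + j * w ∎
    where open ≡-Reasoning

  extend-minimumWeight : ∀ {n d} j z (cs : Vec (Column k) n) → MinimumWeight cs d →
    MinimumWeight (extend j z cs) (d + j * w)
  extend-minimumWeight {d = d} j z cs mw = record
    { lower = λ v v≢0 → subst (d + j * w ≤_) (sym (extend-weight j z cs v v≢0)) (+-monoˡ-≤ (j * w) (lower v v≢0))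
    ; attained = v , v≢0 , trans (extend-weight j z cs v v≢0) (cong (_+ j * w) v-weight) }
    where
    open MinimumWeight mw
    v = proj₁ attained
    v≢0 = proj₁ (proj₂ attained)
    v-weight = proj₂ (proj₂ attained)

O A B C : Sym
O = false , false
A = true , false
B = false , true
C = true , true

col : Sym → Sym → Sym → Sym → Sym → Column 5
col a b c d e = a ∷ b ∷ c ∷ d ∷ e ∷ []

-- A candidate code of minimum weight b, on b + excess positions (its minimum
-- weight is verified below).
record BaseCode (b : ℕ) : Set where
  constructor baseCode
  field
    excess : ℕ
    columns : Vec (Column 5) (b + excess)
open BaseCode

oneWeightCode : Vec (Column 5) 31
oneWeightCode =
  ( col A B O O O ∷ col O A B O O ∷ col O O A B O ∷ col O O O A B ∷ col B O B O A ∷ col A B A B O ∷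
    col O A B A B ∷ col B O C B A ∷ col A B A C B ∷ col B A O A C ∷ col C B B O A ∷ col A C C B O ∷
    col O A C C B ∷ col B O C C C ∷ col C B C C C ∷ col C C A C C ∷ col C C O A C ∷ col C C O O A ∷
    col A C B O O ∷ col O A C B O ∷ col O O A C B ∷ col B O B A C ∷ col C B C B A ∷ col A C C C B ∷
    col B A A C C ∷ col C B B A C ∷ col C C A B A ∷ col A C B A B ∷ col B A A B A ∷ col A B O A B ∷
    col B A O O A ∷ [])

-- Literal patterns are limited to 20: twenty+ k matches 20 + k.
pattern twenty+_ k = suc (suc (suc (suc (suc (suc (suc (suc (suc (suc (suc (suc (suc (suc (suc (suc (suc (suc (suc (suc k)))))))))))))))))))

base : ∀ b → BaseCode b
base 1 = baseCode 2
  ( col B A A B O ∷ col O B C A B ∷ col A O O B O ∷ [])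
base 2 = baseCode 2
  ( col O A O A B ∷ col O C A O B ∷ col C B A B B ∷ col B C A B O ∷ [])
base 3 = baseCode 2
  ( col A C A B B ∷ col A A B O B ∷ col B B B A B ∷ col B O C A B ∷ col C O O A B ∷ [])
base 4 = baseCode 2
  ( col A A B A B ∷ col O A A A B ∷ col C A A O B ∷ col B B C A B ∷ col A B A A B ∷ col B O B A B ∷ [])
base 5 = baseCode 2
  ( col C A B O B ∷ col C C A B O ∷ col O A A B B ∷ col A O B A B ∷ col B A O B B ∷ col A O O O B ∷
    col O B A B O ∷ [])
base 6 = baseCode 2
  ( col A O A B O ∷ col A A B O B ∷ col O B A A B ∷ col B O A O B ∷ col B C O A B ∷ col B A O B O ∷
    col O C C A B ∷ col A A A A B ∷ [])
base 7 = baseCode 3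
  ( col O A A O B ∷ col B A B A B ∷ col C C O A B ∷ col A O B B B ∷ col B O A B B ∷ col A A O B O ∷
    col C A A B O ∷ col A B O A B ∷ col O B A B B ∷ col O O C A B ∷ [])
base 8 = baseCode 3
  ( col C C B A B ∷ col C A C A B ∷ col A O O B O ∷ col B A C A B ∷ col A C A B O ∷ col A O B O O ∷
    col B O A A B ∷ col B A A B B ∷ col O A O O B ∷ col O A A B B ∷ col C B A O B ∷ [])
base 9 = baseCode 4
  ( col B A B B O ∷ col O A A B B ∷ col O A B A B ∷ col O A C A B ∷ col A B A A B ∷ col C O A B B ∷
    col A B B A B ∷ col A A B A B ∷ col C B A O B ∷ col O O O A B ∷ col A A B O O ∷ col B C B A B ∷
    col B O A O B ∷ [])
base 10 = baseCode 4
  ( col O A B B O ∷ col A B B O O ∷ col O A C A B ∷ col C O A A B ∷ col O B B A B ∷ col A A B A B ∷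
    col A O A O B ∷ col B B A B B ∷ col O O A B B ∷ col B A B O B ∷ col A C A B B ∷ col B C O A B ∷
    col A O O B O ∷ col B C A B O ∷ [])
base 11 = baseCode 4
  ( col B A A B B ∷ col A B A B B ∷ col A B O B O ∷ col C A B O B ∷ col O A C A B ∷ col O O A B B ∷
    col B A O B O ∷ col B O A A B ∷ col B B O A B ∷ col O A A O B ∷ col A B A O B ∷ col O A B B B ∷
    col B A B B O ∷ col A B O O B ∷ col A C A B O ∷ [])
base 12 = baseCode 4
  ( col O O B A B ∷ col A B A B O ∷ col O B A B B ∷ col A A O A B ∷ col C O A B O ∷ col B O C A B ∷
    col O C O A B ∷ col B A O O B ∷ col C A B B O ∷ col C A A B B ∷ col O O O A B ∷ col A C B A B ∷
    col A B B B O ∷ col B B A A B ∷ col C B C A B ∷ col B A A O B ∷ [])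
base 13 = baseCode 5
  ( col C O A B O ∷ col B A B A B ∷ col B C O A B ∷ col C O A O B ∷ col B O A O B ∷ col C O A B O ∷
    col O A B A B ∷ col C B C A B ∷ col A B B O B ∷ col A B O O O ∷ col O B A O B ∷ col C C A B B ∷
    col O A A B B ∷ col B C A B O ∷ col B C C A B ∷ col B A C A B ∷ col A A O B O ∷ col A C A B B ∷ [])
base 14 = baseCode 5
  ( col A B O O B ∷ col C B C A B ∷ col O A O B O ∷ col A A A A B ∷ col C O A B B ∷ col A C A B B ∷
    col O B A A B ∷ col B O O A B ∷ col B A C A B ∷ col O O A O B ∷ col C A B O O ∷ col B O A A B ∷
    col O C C A B ∷ col A A C A B ∷ col C A B B O ∷ col C C O A B ∷ col A B O A B ∷ col O A B O O ∷
    col A A A O B ∷ [])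
base 15 = baseCode 5
  ( col B B A O B ∷ col O B A A B ∷ col C C A B B ∷ col A B O B O ∷ col A O A B O ∷ col A B A B B ∷
    col A A O O B ∷ col A A B B O ∷ col A O C A B ∷ col O B A B O ∷ col B C A B B ∷ col O A O B B ∷
    col C O B A B ∷ col B A A A B ∷ col O B O A B ∷ col B A B O B ∷ col A C C A B ∷ col A B B O O ∷
    col O A A A B ∷ col C O O A B ∷ [])
base 16 = baseCode 5
  ( col C C A B O ∷ col A A A B O ∷ col B O O A B ∷ col B A A B O ∷ col A O A O B ∷ col O B A B B ∷
    col B C O A B ∷ col B B A A B ∷ col C O A A B ∷ col A B O O O ∷ col A O B O B ∷ col O C C A B ∷
    col O C A B B ∷ col A B C A B ∷ col O O A B B ∷ col A C O A B ∷ col O A A A B ∷ col B C B A B ∷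
    col B A B B B ∷ col A A B O B ∷ col A B O A B ∷ [])
base 17 = baseCode 6
  ( col B A O O B ∷ col C C A A B ∷ col A C B A B ∷ col C B A A B ∷ col A B B O O ∷ col C B B A B ∷
    col O A O A B ∷ col C A O B O ∷ col B A B O O ∷ col A O C A B ∷ col C B A B B ∷ col B C A B B ∷
    col O O A B B ∷ col B O C A B ∷ col C O C A B ∷ col A C O A B ∷ col A B O O O ∷ col O A O A B ∷
    col A B B A B ∷ col O O A B O ∷ col B O B A B ∷ col A C A A B ∷ col O C A A B ∷ [])
base 18 = baseCode 6
  ( col B A B B O ∷ col O O O A B ∷ col A C A B B ∷ col O C B A B ∷ col A A B O O ∷ col A O O B B ∷
    col B B B A B ∷ col C B A B B ∷ col A A B B O ∷ col O A O B B ∷ col A O B A B ∷ col A A O A B ∷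
    col A O B O B ∷ col O B A O B ∷ col A B O A B ∷ col A O B B B ∷ col B A B O B ∷ col B A A A B ∷
    col O B A B O ∷ col B C O A B ∷ col O C A B O ∷ col C B A A B ∷ col B C A B O ∷ col C O A O B ∷ [])
base 19 = baseCode 6
  ( col C A B B B ∷ col B B B A B ∷ col A B O A B ∷ col A B A A B ∷ col O A B O O ∷ col A O O A B ∷
    col B O O A B ∷ col C A B O O ∷ col B C C A B ∷ col A B O O B ∷ col O A C A B ∷ col O O A A B ∷
    col A O B O O ∷ col O O C A B ∷ col O A B A B ∷ col A B B B O ∷ col C C A B O ∷ col A A A B O ∷
    col C B A O B ∷ col A C B A B ∷ col C O C A B ∷ col C A B O B ∷ col C C A B B ∷ col B A O A B ∷
    col B A B B B ∷ [])
base 20 = baseCode 6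
  ( col C A B B O ∷ col B B A A B ∷ col O A C A B ∷ col A B O O B ∷ col C C A B O ∷ col B A O A B ∷
    col C O A B B ∷ col B B O A B ∷ col O A A O B ∷ col O O O A B ∷ col B A B O O ∷ col B A B O B ∷
    col O A O A B ∷ col O O A B B ∷ col A C B A B ∷ col A A O B O ∷ col C O B A B ∷ col O B A B B ∷
    col B A A B O ∷ col A B B O B ∷ col A B A A B ∷ col B O A O B ∷ col A B B B O ∷ col B A B B B ∷
    col C A A B B ∷ col A O C A B ∷ [])
base (twenty+ 1) = baseCode 7
  ( col A A A B B ∷ col B A O O B ∷ col O O A O B ∷ col O A B B B ∷ col A O C A B ∷ col C A B B B ∷
    col C A C A B ∷ col O B O A B ∷ col A B O O O ∷ col A O O B O ∷ col C B A O B ∷ col B C B A B ∷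
    col C A B A B ∷ col A A B A B ∷ col C B O A B ∷ col C C A B O ∷ col O O A B B ∷ col B C A B B ∷
    col A B A B O ∷ col A A O A B ∷ col C A B B O ∷ col O C A B B ∷ col A B A A B ∷ col O A A O B ∷
    col A B A O B ∷ col A B B B O ∷ col B C O A B ∷ col C A A O B ∷ [])
base (twenty+ 2) = baseCode 7
  ( col A O B O O ∷ col C B C A B ∷ col O B C A B ∷ col C B A B O ∷ col O B A A B ∷ col C A O B B ∷
    col B A O A B ∷ col B B O A B ∷ col A B B A B ∷ col A A A O B ∷ col A O A B B ∷ col O A A A B ∷
    col C O A A B ∷ col B C A O B ∷ col C A B B B ∷ col O A B O B ∷ col C C B A B ∷ col B A B B O ∷
    col B C A O B ∷ col A O O B B ∷ col A A B O O ∷ col O C A O B ∷ col O C O A B ∷ col B A A A B ∷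
    col A A A A B ∷ col B A O B O ∷ col B A O B B ∷ col A A A B O ∷ col O B A B O ∷ [])
base (twenty+ 3) = baseCode 7
  ( col A A A A B ∷ col C O B A B ∷ col A B O O B ∷ col A O C A B ∷ col A O A A B ∷ col A B A B B ∷
    col C A B O O ∷ col O O A B B ∷ col C C O A B ∷ col O A O O B ∷ col C A O B B ∷ col O A B B O ∷
    col O C A A B ∷ col A A A B O ∷ col B C A A B ∷ col O O A B O ∷ col O C A B O ∷ col C A O B O ∷
    col A A A B O ∷ col A B B O B ∷ col A B C A B ∷ col A O B O B ∷ col B B A B B ∷ col B C B A B ∷
    col O A A B B ∷ col C A B A B ∷ col C A A O B ∷ col C O A O B ∷ col C B B A B ∷ col B A O B B ∷ [])
base (twenty+ 4) = baseCode 7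
  ( col B O A O B ∷ col A A O A B ∷ col O A B B O ∷ col A B O O O ∷ col C A O B O ∷ col A A A B B ∷
    col C A O A B ∷ col A O A B O ∷ col C O C A B ∷ col C C A O B ∷ col C A A O B ∷ col B C O A B ∷
    col B C A B B ∷ col A A A A B ∷ col A B A O B ∷ col A B B O B ∷ col O C A B B ∷ col A A O B O ∷
    col B A O B B ∷ col C B B A B ∷ col A B A A B ∷ col O B A B O ∷ col A O A O B ∷ col B A A B O ∷
    col O O C A B ∷ col O O B A B ∷ col O B A A B ∷ col A O B B B ∷ col B C A A B ∷ col A C C A B ∷
    col O B A B B ∷ [])
base (twenty+ 5) = baseCode 8
  ( col B A B O O ∷ col B B A B O ∷ col B O B A B ∷ col O A A B O ∷ col B O C A B ∷ col C O A O B ∷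
    col A O B O O ∷ col C B C A B ∷ col O A B B B ∷ col B O A A B ∷ col A C A A B ∷ col A B C A B ∷
    col C A O B O ∷ col C C A O B ∷ col A C A B O ∷ col O A A A B ∷ col O B A O B ∷ col B C O A B ∷
    col A B O O B ∷ col O A O B B ∷ col A B O O O ∷ col A A O A B ∷ col B O C A B ∷ col A B B A B ∷
    col C O B A B ∷ col A A O B B ∷ col A A O B O ∷ col O C A B B ∷ col A A A B B ∷ col A A C A B ∷
    col O A A A B ∷ col A A B A B ∷ col B A A O B ∷ [])
base (twenty+ 6) = baseCode 8
  ( col C O A B B ∷ col O O A B O ∷ col A B C A B ∷ col O O A B B ∷ col O A B B B ∷ col C B A A B ∷
    col A A B B O ∷ col B B O A B ∷ col B A C A B ∷ col B C B A B ∷ col B A A B O ∷ col A C A O B ∷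
    col A O B O O ∷ col A A A B B ∷ col B A A B B ∷ col O C C A B ∷ col C A B A B ∷ col A B O B O ∷
    col A B B O B ∷ col B A O B B ∷ col O A C A B ∷ col A A A A B ∷ col C O A O B ∷ col A O B A B ∷
    col A O B A B ∷ col C A O O B ∷ col A A O B O ∷ col B C O A B ∷ col O A B O O ∷ col A A A O B ∷
    col O B O A B ∷ col O A A A B ∷ col A O B B O ∷ col C A O O B ∷ [])
base _ = baseCode 0 (replicate _ zeroColumn)

oneWeightCode-weight : ∀ v → Nonzero v → weight oneWeightCode v ≡ 24
oneWeightCode-weight v v≢0 = ≡ᵇ⇒≡ _ 24 (everyNonzero-sound 5 (λ v → weight oneWeightCode v ≡ᵇ 24) _ v v≢0)

base-minimumWeight : ∀ {b} → b < 27 → minimumWeight (columns (base b)) ≡ b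
base-minimumWeight = from-yes (allUpTo? (λ b → minimumWeight (columns (base b)) ≟ b) 27)

base-excess : ∀ {b} → b < 27 → 3 ≤ b → 3 * excess (base b) ≤ ceilingSum b + 2
base-excess = from-yes (allUpTo? (λ b → 3 ≤? b →-dec 3 * excess (base b) ≤? ceilingSum b + 2) 27)

open Extension oneWeightCode oneWeightCode-weight

codeFor : ∀ b j z → 1 ≤ b → b < 27 → AdditiveCode ((b + excess (base b)) + (j * 31 + z)) 5 (b + j * 24)
codeFor b j z 1≤b b<27 = toAdditiveCode (extend j z (columns (base b))) (≤-trans 1≤b (m≤m+n b (j * 24)))
  (extend-minimumWeight j z (columns (base b))
    (subst (MinimumWeight (columns (base b))) (base-minimumWeight b<27) (minimumWeight-correct (columns (base b)))))

⌈/⌉-shift : ∀ x q m → ⌈ x + q * suc m /suc m ⌉ ≡ ⌈ x /suc m ⌉ + q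
⌈/⌉-shift x q m = trans (/-congˡ {o = suc m} (swap x (q * suc m) m)) (/-+-multiple (x + m) q (suc m))
  where
  swap : ∀ x y m → x + y + m ≡ x + m + y
  swap = solve-∀

ceilingSum-shift : ∀ x q → ceilingSum (x + q * 24) ≡ ceilingSum x + q * 21
ceilingSum-shift x q =
  trans (cong₂ _+_ (cong₂ _+_ (shift 12 1 solve-∀) (shift 6 3 solve-∀)) (shift 3 7 solve-∀))
        (regroup ⌈ x /suc 1 ⌉ ⌈ x /suc 3 ⌉ ⌈ x /suc 7 ⌉ q)
  where
  shift : ∀ a m → (∀ q → q * 24 ≡ q * a * suc m) → ⌈ x + q * 24 /suc m ⌉ ≡ ⌈ x /suc m ⌉ + q * a
  shift a m 24≡ = trans (cong (λ y → ⌈ x + y /suc m ⌉) (24≡ q)) (⌈/⌉-shift x (q * a) m)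

  regroup : ∀ a b c q → a + q * 12 + (b + q * 6) + (c + q * 3) ≡ a + b + c + q * 21
  regroup = solve-∀

≤-÷3 : ∀ a x → 3 * a ≤ 3 * x + 2 → a ≤ x
≤-÷3 a x 3a≤ = ≤-pred (*-cancelˡ-< 3 a (suc x) (≤-trans (s≤s 3a≤) (≤-reflexive (next x))))
  where
  next : ∀ x → suc (3 * x + 2) ≡ 3 * suc x
  next = solve-∀

-- The length budget: if d = b + 24 j (3 ≤ b ≤ 26) satisfies the inequality of
-- the theorem with redundancy m = n - d, then the base code and the j
-- one-weight blocks need at most m positions beyond d.
budget : ∀ b j m → 3 ≤ b → b < 27 → ceilingSum (b + j * 24) ≤ 3 * m → excess (base b) + j * 7 ≤ m
budget b j m 3≤b b<27 bound = ≤-÷3 (excess (base b) + j * 7) m (begin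
  3 * (e + j * 7)              ≡⟨ distribute e j ⟩
  3 * e + j * 21               ≤⟨ +-monoˡ-≤ (j * 21) (base-excess b<27 3≤b) ⟩
  ceilingSum b + 2 + j * 21    ≡⟨ +-comm-2 (ceilingSum b) j ⟩
  ceilingSum b + j * 21 + 2    ≡⟨ cong (_+ 2) (ceilingSum-shift b j) ⟨
  ceilingSum (b + j * 24) + 2  ≤⟨ +-monoˡ-≤ 2 bound ⟩
  3 * m + 2                    ∎)
  where
  open ≤-Reasoning
  e = excess (base b)
  distribute : ∀ e j → 3 * (e + j * 7) ≡ 3 * e + j * 21
  distribute = solve-∀
  +-comm-2 : ∀ c j → c + 2 + j * 21 ≡ c + j * 21 + 2
  +-comm-2 = solve-∀

record Assembly (n d : ℕ) : Set where
  field
    b j : ℕ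
    1≤b : 1 ≤ b
    b<27 : b < 27
    d≡ : d ≡ b + j * 24
    fits : (b + excess (base b)) + j * 31 ≤ n

-- Every (n, d) allowed by the theorem admits an assembly: d ≤ 2 uses the base
-- codes directly, and d ≥ 3 is written as d = (3 + r) + 24 j with r < 24.
assemble : ∀ n d → 1 ≤ d → 2 + d ≤ n → ceilingSum d ≤ 3 * (n ∸ d) → Assembly n d
assemble n zero () _ _
assemble n 1 _ 3≤n _ = record { b = 1 ; j = 0 ; 1≤b = s≤s z≤n ; b<27 = s≤s (s≤s z≤n) ; d≡ = refl ; fits = 3≤n }
assemble n 2 _ 4≤n _ = record { b = 2 ; j = 0 ; 1≤b = s≤s z≤n ; b<27 = s≤s (s≤s (s≤s z≤n)) ; d≡ = refl ; fits = 4≤n }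
assemble n d@(suc (suc (suc e))) _ 2+d≤n bound = record
  { b = b ; j = j ; 1≤b = s≤s z≤n ; b<27 = small ; d≡ = d≡ ; fits = fits }
  where
  j = e / 24
  b = 3 + e % 24
  small : b < 27
  small = +-monoʳ-< 3 (m%n<n e 24)

  d≡ : d ≡ b + j * 24
  d≡ = cong (3 +_) (m≡m%n+[m/n]*n e 24)

  d≤n : d ≤ n
  d≤n = ≤-trans (m≤n+m d 2) 2+d≤n

  room : excess (base b) + j * 7 ≤ n ∸ d
  room = budget b j (n ∸ d) (s≤s (s≤s (s≤s z≤n))) small
    (subst (λ x → ceilingSum x ≤ 3 * (n ∸ d)) d≡ bound)

  fits : (b + excess (base b)) + j * 31 ≤ n
  fits = begin
    (b + excess (base b)) + j * 31            ≡⟨ regroup b (excess (base b)) j ⟩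
    (b + j * 24) + (excess (base b) + j * 7)  ≡⟨ cong (_+ (excess (base b) + j * 7)) d≡ ⟨
    d + (excess (base b) + j * 7)             ≤⟨ +-monoʳ-≤ d room ⟩
    d + (n ∸ d)                               ≡⟨ m+[n∸m]≡n d≤n ⟩
    n                                         ∎
    where
    open ≤-Reasoning
    regroup : ∀ b x j → b + x + j * 31 ≡ b + j * 24 + (x + j * 7)
    regroup = solve-∀

sufficiency : ∀ n d → 1 ≤ d → 2 + d ≤ n → ceilingSum d ≤ 3 * (n ∸ d) → AdditiveCode n 5 d
sufficiency n d 1≤d 2+d≤n bound =
  subst₂ (λ n' d' → AdditiveCode n' 5 d') length≡ (sym d≡) (codeFor b j z 1≤b b<27)
  where
  open Assembly (assemble n d 1≤d 2+d≤n bound)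
  z = n ∸ ((b + excess (base b)) + j * 31)
  length≡ : (b + excess (base b)) + (j * 31 + z) ≡ n
  length≡ = trans (sym (+-assoc (b + excess (base b)) (j * 31) z)) (m+[n∸m]≡n fits)

theorem2 : (n d : ℕ) → 1 ≤ n → 1 ≤ d → d < n ∸ 1 →
    (AdditiveCode n 5 d ⇔ (⌈ d /suc 1 ⌉ + ⌈ d /suc 3 ⌉ + ⌈ d /suc 7 ⌉ ≤ 3 * (n ∸ d)))
theorem2 n d 1≤n 1≤d d<n-1 = mk⇔ (necessity n d) (sufficiency n d 1≤d 2+d≤n)
  where
  2+d≤n : 2 + d ≤ n
  2+d≤n = subst (2 + d ≤_) (m+[n∸m]≡n 1≤n) (+-monoʳ-≤ 1 d<n-1)
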